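{- Let $D$ be a minimal strong digraph, let $C_q$ be a directed cycle of length $q\ge 2$ contained in $D$, and let $D'$ be the digraph obtained from $D$ by deleting all arcs of $C_q$. If a strong component $S$ of $D'$ contains $\lambda>1$ vertices of $C_q$, then $S$ contains at least $\lambda$ vertices which are linear vertices of $D$.
   Context: An arc $uv$ of a digraph is transitive if there is another directed $uv$-path not using the arc $uv$. A minimal strong digraph is a strongly connected digraph with no transitive arcs. A strong component is a maximal strongly connected subdigraph. A vertex $v$ of $D$ is linear if its indegree and outdegree in $D$ are both equal to $1$. -}

module Defs where

open import Data.Nat using (ℕ; zero; suc; _+_; _≡ᵇ_)
open import Data.Fin using (Fin; zero; suc; toℕ; fromℕ; inject₁)
open import Data.Bool using (Bool; true; false; T; _∧_; if_then_else_)
open import Data.Product using (Σ; ∃; _×_)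
open import Data.Sum using (_⊎_)
open import Relation.Nullary using (¬_)
open import Relation.Binary.PropositionalEquality using (_≡_)
open import Function.Definitions using (Injective)

-- A digraph on vertex set Fin n, given by its (Boolean) adjacency relation.
-- No parallel arcs by construction; loops are excluded by 'Loopless'.
Digraph : ℕ → Set
Digraph n = Fin n → Fin n → Bool

Arc : ∀ {n} → Digraph n → Fin n → Fin n → Set
Arc D u v = T (D u v)

Loopless : ∀ {n} → Digraph n → Set
Loopless D = ∀ v → D v v ≡ false

count : ∀ {m} → (Fin m → Bool) → ℕ
count {zero}  f = 0
count {suc m} f = (if f zero then 1 else 0) + count (λ i → f (suc i))

outdeg indeg : ∀ {n} → Digraph n → Fin n → ℕ
outdeg D v = count (λ w → D v w)
indeg  D v = count (λ u → D u v)

linearᵇ : ∀ {n} → Digraph n → Fin n → Bool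
linearᵇ D v = (indeg D v ≡ᵇ 1) ∧ (outdeg D v ≡ᵇ 1)

record Path {n} (E : Fin n → Fin n → Set) (u v : Fin n) : Set where
  field
    len   : ℕ
    vert  : Fin (suc len) → Fin n
    start : vert zero ≡ u
    end   : vert (fromℕ len) ≡ v
    inj   : Injective _≡_ _≡_ vert
    arcs  : ∀ (i : Fin len) → E (vert (inject₁ i)) (vert (suc i))

TransitiveArc : ∀ {n} → Digraph n → Fin n → Fin n → Set
TransitiveArc D u v =
  Arc D u v × Path (λ x y → Arc D x y × ¬ (x ≡ u × y ≡ v)) u v

Induced : ∀ {n} → (Fin n → Fin n → Set) → (Fin n → Bool) → Fin n → Fin n → Set
Induced E S x y = E x y × T (S x) × T (S y)

StronglyConnectedOn : ∀ {n} → (Fin n → Fin n → Set) → (Fin n → Bool) → Set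
StronglyConnectedOn E S = ∀ u v → T (S u) → T (S v) → Path (Induced E S) u v

StrongDigraph : ∀ {n} → Digraph n → Set
StrongDigraph D = ∀ u v → Path (Arc D) u v

MinimalStrong : ∀ {n} → Digraph n → Set
MinimalStrong D = Loopless D × StrongDigraph D × (∀ u v → ¬ TransitiveArc D u v)

StrongComponent : ∀ {n} → (Fin n → Fin n → Set) → (Fin n → Bool) → Set
StrongComponent E S =
  (∃ λ v → T (S v)) × StronglyConnectedOn E S ×
  (∀ S' → (∀ v → T (S v) → T (S' v)) → StronglyConnectedOn E S' → ∀ v → T (S' v) → T (S v))

CycSucc : ∀ {q} → Fin q → Fin q → Set
CycSucc {q} i j = (suc (toℕ i) ≡ toℕ j) ⊎ (suc (toℕ i) ≡ q × toℕ j ≡ 0)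

record DirectedCycle {n} (D : Digraph n) (q : ℕ) : Set where
  field
    vert : Fin q → Fin n
    inj  : Injective _≡_ _≡_ vert
    arcs : ∀ i j → CycSucc i j → Arc D (vert i) (vert j)

CycleArc : ∀ {n} {D : Digraph n} {q} → DirectedCycle D q → Fin n → Fin n → Set
CycleArc {q = q} C u v =
  Σ (Fin q) λ i → Σ (Fin q) λ j → CycSucc i j × DirectedCycle.vert C i ≡ u × DirectedCycle.vert C j ≡ v

DeleteCycle : ∀ {n} (D : Digraph n) {q} → DirectedCycle D q → Fin n → Fin n → Set
DeleteCycle D C x y = Arc D x y × ¬ CycleArc C x y

cycleVerticesIn : ∀ {n} {D : Digraph n} {q} → DirectedCycle D q → (Fin n → Bool) → ℕ
cycleVerticesIn C S = count (λ i → S (DirectedCycle.vert C i))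

linearVerticesIn : ∀ {n} → Digraph n → (Fin n → Bool) → ℕ
linearVerticesIn D S = count (λ v → S v ∧ linearᵇ D v)

-- Call an arc a → b a dominator of z when every walk from the cycle to z uses it. For a cycle
-- vertex x ∈ S, the first arc x → a of a path in S to another cycle vertex of S is not a cycle
-- arc, so going round the cycle shows that it would be transitive unless it dominates a. From an
-- arc u → y dominating y ∈ S we move on to an arc y → y′ dominating y′ ∈ S until y is linear: a
-- second out-arc of y yields, by non-transitivity and the maximality of S, a dominating out-arc
-- into S, and a second in-arc w → y forces the unique out-arc of y to dominate w and hence its
-- head. The set of vertices dominated by the current arc strictly shrinks, so this ends at a
-- linear vertex ℓ ∈ S dominated by an arc leaving x. No vertex is dominated by arcs leaving two
-- different cycle vertices, so x ↦ ℓ is injective.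

module Submission where

open import Defs
open import Data.Nat using (ℕ; zero; suc; _≤_; _<_; z≤n; s≤s; s≤s⁻¹)
open import Data.Nat.Properties as ℕ using (≡⇒≡ᵇ)
open import Data.Fin using (Fin; zero; suc; toℕ; fromℕ; inject₁; _≟_)
open import Data.Fin.Properties using (any?; toℕ-fromℕ; suc-injective)
open import Data.Bool using (Bool; true; false; T; not; _∧_; _∨_)
open import Data.Bool.Properties using (T-∧; T-∨; T?)
open import Data.Product using (Σ; ∃; ∃₂; _×_; _,_; proj₁; proj₂)
open import Data.Sum using (_⊎_; inj₁; inj₂)
open import Data.Empty using (⊥-elim)
open import Data.List using (List; []; _∷_)
open import Data.List.Membership.Propositional using (_∈_)
open import Data.List.Relation.Unary.Any using (here; there)
open import Data.List.Relation.Binary.Subset.Propositional using (_⊆_)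
open import Data.List.Relation.Binary.Subset.Propositional.Properties using (∷⁺ʳ)
open import Function using (_∘_; id)
open import Function.Bundles using (Equivalence)
open import Relation.Binary.Definitions using (DecidableEquality)
open import Relation.Binary.Construct.Closure.ReflexiveTransitive as Star using (Star; ε; _◅_; _◅◅_; gmap)
open import Relation.Nullary using (¬_; yes; no; does)
open import Relation.Nullary.Decidable using (⌊_⌋; toWitness; fromWitness; ¬?; _×-dec_; _⊎-dec_)
open import Relation.Unary using (Decidable)
open import Relation.Binary.PropositionalEquality using (_≡_; _≢_; refl; sym; trans; cong; subst; subst₂)

open Equivalence using (to; from)

module _ {V : Set} where

  infixl 5 _∖_ _⇂_

  _∖_ : (V → V → Set) → V × V → V → V → Set
  (E ∖ (a , b)) x y = E x y × ¬ (x ≡ a × y ≡ b)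

  _⇂_ : (V → V → Set) → (V → Set) → V → V → Set
  (E ⇂ P) x y = E x y × P x

  ⇂≢⇒∖ : ∀ {E : V → V → Set} {a b x y} → (E ⇂ (_≢ a)) x y → (E ∖ (a , b)) x y
  ⇂≢⇒∖ (e , x≢a) = e , x≢a ∘ proj₁

  first-arc : ∀ {E : V → V → Set} {x z} → Star E x z → x ≢ z → ∃ (E x)
  first-arc ε x≢x = ⊥-elim (x≢x refl)
  first-arc (e ◅ _) _ = _ , e

  vertices : ∀ {E : V → V → Set} {x z} → Star E x z → List V
  vertices {x = x} ε = x ∷ []
  vertices {x = x} (_ ◅ p) = x ∷ vertices p

  start∈vertices : ∀ {E : V → V → Set} {x z} (p : Star E x z) → x ∈ vertices p
  start∈vertices ε = here refl
  start∈vertices (_ ◅ _) = here refl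

  split-at-vertex : ∀ {E : V → V → Set} {x z v} (p : Star E x z) → v ∈ vertices p →
    Σ (Star E x v) λ pre → Σ (Star E v z) λ suf → vertices pre ⊆ vertices p × vertices suf ⊆ vertices p
  split-at-vertex ε (here refl) = ε , ε , id , id
  split-at-vertex (e ◅ p) (here refl) = ε , e ◅ p , (λ { (here refl) → here refl }) , id
  split-at-vertex (e ◅ p) (there v∈p) with split-at-vertex p v∈p
  ... | pre , suf , pre⊆ , suf⊆ = e ◅ pre , suf , ∷⁺ʳ _ pre⊆ , there ∘ suf⊆

  induce : ∀ {E : V → V → Set} {P : V → Set} {x z} (p : Star E x z) → (∀ {v} → v ∈ vertices p → P v) →
    Star (λ a b → E a b × P a × P b) x z
  induce ε _ = ε
  induce (e ◅ p) inP = (e , inP (here refl) , inP (there (start∈vertices p))) ◅ induce p (inP ∘ there)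

module Walks {V : Set} (_≟ᵥ_ : DecidableEquality V) {E : V → V → Set} where

  split-at-last-use : ∀ {a b x z} → Star E x z →
    Star (E ∖ (a , b)) x z ⊎ (Star E x a × E a b × Star (E ∖ (a , b)) b z)
  split-at-last-use ε = inj₁ ε
  split-at-last-use {a} {b} (_◅_ {x} {v} e p) with split-at-last-use p
  ... | inj₂ (pre , ab , suf) = inj₂ (e ◅ pre , ab , suf)
  ... | inj₁ p′ with (x ≟ᵥ a) ×-dec (v ≟ᵥ b)
  ...   | yes (refl , refl) = inj₂ (ε , e , p′)
  ...   | no ne = inj₁ ((e , ne) ◅ p′)

  first-hit : ∀ {P : V → Set} → Decidable P → ∀ {x z} → Star E x z → P z →
    ∃ λ r → P r × Star (E ⇂ (¬_ ∘ P)) x r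
  first-hit P? ε pz = _ , pz , ε
  first-hit P? (_◅_ {x} e p) pz with P? x
  ... | yes px = x , px , ε
  ... | no ¬px with first-hit P? p pz
  ...   | r , pr , q = r , pr , (e , ¬px) ◅ q

  never-leaving-or-last-exit : ∀ {y x z} → Star E x z →
    Star (E ⇂ (_≢ y)) x z ⊎ ∃ λ b → E y b × Star (E ⇂ (_≢ y)) b z
  never-leaving-or-last-exit ε = inj₁ ε
  never-leaving-or-last-exit {y} (_◅_ {x} {v} e p) with never-leaving-or-last-exit p
  ... | inj₂ exit = inj₂ exit
  ... | inj₁ p′ with x ≟ᵥ y
  ...   | yes refl = inj₂ (v , e , p′)
  ...   | no x≢y = inj₁ ((e , x≢y) ◅ p′)

  last-exit : ∀ {y z} → Star E y z → z ≢ y → ∃ λ b → E y b × Star (E ⇂ (_≢ y)) b z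
  last-exit p z≢y with never-leaving-or-last-exit p
  ... | inj₂ e = e
  ... | inj₁ ε = ⊥-elim (z≢y refl)
  ... | inj₁ ((_ , y≢y) ◅ _) = ⊥-elim (y≢y refl)

  never-leaving-start : ∀ {y x z} → Star (E ⇂ (_≢ y)) x z → z ≢ y → x ≢ y
  never-leaving-start ε z≢y = z≢y
  never-leaving-start ((_ , x≢y) ◅ _) _ = x≢y

  never-leaving-avoids-entering : ∀ {u y x z} → Star (E ⇂ (_≢ y)) x z → z ≢ y → Star (E ∖ (u , y)) x z
  never-leaving-avoids-entering ε _ = ε
  never-leaving-avoids-entering ((e , _) ◅ p) z≢y =
    (e , never-leaving-start p z≢y ∘ proj₂) ◅ never-leaving-avoids-entering p z≢y

module _ {n} {E : Fin n → Fin n → Set} where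
  open Path

  fromPath : ∀ {u w} → Path E u w → Star E u w
  fromPath P = subst₂ (Star E) (start P) (end P) (along (len P) (vert P) (arcs P))
    where
      along : ∀ m (f : Fin (suc m) → Fin n) → (∀ i → E (f (inject₁ i)) (f (suc i))) →
              Star E (f zero) (f (fromℕ m))
      along zero f _ = ε
      along (suc m) f e = e zero ◅ along m (f ∘ suc) (e ∘ suc)

  private
    trivial : ∀ {u} → Path E u u
    trivial {u} = record
      { len = 0 ; vert = λ _ → u ; start = refl ; end = refl ; inj = λ { {zero} {zero} _ → refl } ; arcs = λ () }

    cons : ∀ {u v w} → E u v → (P : Path E v w) → (∀ k → vert P k ≢ u) → Path E u w
    cons {u} e P u∉P = record
      { len = suc (len P) ; vert = vert′ ; start = refl ; end = end P ; inj = inj′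
      ; arcs = λ { zero → subst (E u) (sym (start P)) e ; (suc k) → arcs P k } }
      where
        vert′ : Fin (suc (suc (len P))) → Fin n
        vert′ zero = u
        vert′ (suc k) = vert P k
        inj′ : ∀ {j k} → vert′ j ≡ vert′ k → j ≡ k
        inj′ {zero} {zero} _ = refl
        inj′ {zero} {suc k} eq = ⊥-elim (u∉P k (sym eq))
        inj′ {suc j} {zero} eq = ⊥-elim (u∉P j eq)
        inj′ {suc j} {suc k} eq = cong suc (inj P eq)

    suffix : ∀ {u w} (P : Path E u w) (k : Fin (suc (len P))) → Path E (vert P k) w
    suffix P zero = record { len = len P ; vert = vert P ; start = refl ; end = end P ; inj = inj P ; arcs = arcs P }
    suffix record { len = suc l ; vert = f ; end = e ; inj = i ; arcs = a } (suc k) =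
      suffix (record { len = l ; vert = f ∘ suc ; start = refl ; end = e ; inj = suc-injective ∘ i ; arcs = a ∘ suc })
             k

  toPath : ∀ {u w} → Star E u w → Path E u w
  toPath ε = trivial
  toPath (_◅_ {u} e p) with toPath p
  ... | P with any? (λ k → vert P k ≟ u)
  ...   | yes (k , eq) = subst (λ x → Path E x _) eq (suffix P k)
  ...   | no u∉P = cons e P (λ k eq → u∉P (k , eq))

module _ {n} {E : Fin n → Fin n → Set} {S : Fin n → Bool} where
  open import Data.List.Membership.DecPropositional (_≟_ {n}) using (_∈?_)

  closed-walk-in-component : StrongComponent E S → ∀ {s v} → T (S s) →
    (Z : Star E s s) → v ∈ vertices Z → T (S v)
  closed-walk-in-component (_ , connected , maximal) {s} s∈S Z v∈Z =
    maximal S′ (λ _ → inj-S) connected′ _ (inj-Z v∈Z)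
    where
      S′ : Fin n → Bool
      S′ v = S v ∨ ⌊ v ∈? vertices Z ⌋
      inj-S : ∀ {v} → T (S v) → T (S′ v)
      inj-S v∈S = from T-∨ (inj₁ v∈S)
      inj-Z : ∀ {v} → v ∈ vertices Z → T (S′ v)
      inj-Z v∈Z = from T-∨ (inj₂ (fromWitness {a? = _ ∈? vertices Z} v∈Z))
      widen : ∀ {a b} → Induced E S a b → Induced E S′ a b
      widen (e , a∈S , b∈S) = e , inj-S a∈S , inj-S b∈S
      to-s : ∀ {u} → T (S′ u) → Star (Induced E S′) u s
      to-s {u} u∈S′ with to T-∨ u∈S′
      ... | inj₁ u∈S = Star.map widen (fromPath (connected u s u∈S s∈S))
      ... | inj₂ u∈Z with split-at-vertex Z (toWitness {a? = u ∈? vertices Z} u∈Z)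
      ...   | _ , suf , _ , suf⊆ = induce suf (inj-Z ∘ suf⊆)
      from-s : ∀ {w} → T (S′ w) → Star (Induced E S′) s w
      from-s {w} w∈S′ with to T-∨ w∈S′
      ... | inj₁ w∈S = Star.map widen (fromPath (connected s w s∈S w∈S))
      ... | inj₂ w∈Z with split-at-vertex Z (toWitness {a? = w ∈? vertices Z} w∈Z)
      ...   | pre , _ , pre⊆ , _ = induce pre (inj-Z ∘ pre⊆)
      connected′ : StronglyConnectedOn E S′
      connected′ u w u∈S′ w∈S′ = toPath (to-s u∈S′ ◅◅ from-s w∈S′)

remove : ∀ {m} → (Fin m → Bool) → Fin m → Fin m → Bool
remove f v w = not (does (w ≟ v)) ∧ f w

T-remove : ∀ {m} {f : Fin m → Bool} {v w} → T (f w) → w ≢ v → T (remove f v w)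
T-remove {v = v} {w} fw w≢v with w ≟ v
... | yes w≡v = ⊥-elim (w≢v w≡v)
... | no _ = fw

T-remove⁻ : ∀ {m} {f : Fin m → Bool} {v w} → T (remove f v w) → T (f w) × w ≢ v
T-remove⁻ {v = v} {w} t with w ≟ v
... | no w≢v = t , w≢v

count-remove : ∀ {m} (f : Fin m → Bool) {v} → T (f v) → count f ≡ suc (count (remove f v))
count-remove {suc m} f {zero} fv with f zero
... | true = refl
count-remove {suc m} f {suc v} fv with f zero
... | true = cong suc (count-remove (f ∘ suc) fv)
... | false = count-remove (f ∘ suc) fv

count-none : ∀ {m} (f : Fin m → Bool) → (∀ v → ¬ T (f v)) → count f ≡ 0
count-none {zero} f _ = refl
count-none {suc m} f none with f zero in eq
... | true = ⊥-elim (none zero (subst T (sym eq) _))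
... | false = count-none (f ∘ suc) (none ∘ suc)

count-unique : ∀ {m} {f : Fin m → Bool} {v} → T (f v) → ¬ (∃ λ w → w ≢ v × T (f w)) → count f ≡ 1
count-unique {f = f} {v} fv unique = trans (count-remove f fv) (cong suc (count-none (remove f v) only-v))
  where
    only-v : ∀ w → ¬ T (remove f v w)
    only-v w t = let fw , w≢v = T-remove⁻ {f = f} t in unique (w , w≢v , fw)

count-witness : ∀ {m} (f : Fin m → Bool) → 0 < count f → ∃ (T ∘ f)
count-witness {suc m} f pos with f zero in eq
... | true = zero , subst T (sym eq) _
... | false = let v , fv = count-witness (f ∘ suc) pos in suc v , fv

count-another : ∀ {m} {f : Fin m → Bool} {v} → 1 < count f → T (f v) → ∃ λ w → w ≢ v × T (f w)
count-another {f = f} {v} 1<count fv with count-witness (remove f v) (s≤s⁻¹ (subst (1 <_) (count-remove f fv) 1<count))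
... | w , t = let fw , w≢v = T-remove⁻ {f = f} t in w , w≢v , fw

count-≤-injection : ∀ {m k} (f : Fin m → Bool) (g : Fin k → Bool) (φ : ∀ v → T (f v) → Fin k) →
  (∀ v fv → T (g (φ v fv))) → (∀ {v w} fv fw → φ v fv ≡ φ w fw → v ≡ w) → count f ≤ count g
count-≤-injection {zero} _ _ _ _ _ = z≤n
count-≤-injection {suc m} f g φ φ∈g φ-inj with f zero in eq
... | false = count-≤-injection (f ∘ suc) g (φ ∘ suc) (φ∈g ∘ suc) (λ fv fw → suc-injective ∘ φ-inj fv fw)
... | true = subst (suc (count (f ∘ suc)) ≤_) (sym (count-remove g (φ∈g zero f0)))
               (s≤s (count-≤-injection (f ∘ suc) (remove g (φ zero f0)) (φ ∘ suc) φ∈g′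
                                       (λ fv fw → suc-injective ∘ φ-inj fv fw)))
  where
    f0 : T (f zero)
    f0 = subst T (sym eq) _
    φ∈g′ : ∀ v fv → T (remove g (φ zero f0) (φ (suc v) fv))
    φ∈g′ v fv = T-remove {f = g} (φ∈g (suc v) fv) (λ φv≡φ0 → 0≢suc (φ-inj f0 fv (sym φv≡φ0)))
      where
        0≢suc : ∀ {v : Fin m} → zero ≢ suc v
        0≢suc ()

linear-from-degrees : ∀ {n} {D : Digraph n} {v} → indeg D v ≡ 1 → outdeg D v ≡ 1 → T (linearᵇ D v)
linear-from-degrees in≡1 out≡1 = from T-∧ (≡⇒≡ᵇ _ _ in≡1 , ≡⇒≡ᵇ _ _ out≡1)

module Dominators {n} (D : Digraph n) {I : Set} (root : I → Fin n) where
  private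
    open module W {E} = Walks (_≟_ {n}) {E}

  Dominates : Fin n → Fin n → Fin n → Set
  Dominates a b z = ∀ i → ¬ Star (Arc D ∖ (a , b)) (root i) z

  dominated-not-root : ∀ {a b z} → Dominates a b z → ∀ i → root i ≢ z
  dominated-not-root dom i refl = dom i ε

  dominates-trans : ∀ {u y b z} → Dominates u y y → Dominates y b z → Dominates u y z
  dominates-trans dom-uy dom-yb i p with split-at-last-use p
  ... | inj₁ p′ = dom-yb i (Star.map (λ ((e , _) , ne) → e , ne) p′)
  ... | inj₂ (pre , _ , _) = dom-uy i pre

  dominates-in-neighbour : ∀ {u y w} → Dominates u y y → Arc D w y → w ≢ u → Dominates u y w
  dominates-in-neighbour dom wy w≢u i p = dom i (p ◅◅ (wy , w≢u ∘ proj₁) ◅ ε)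

  dominates-sole-exit : ∀ {u y b w} → ¬ (∃ λ c → c ≢ b × Arc D y c) → w ≢ y →
    Dominates u y w → Dominates y b w
  dominates-sole-exit {y = y} other-exit w≢y dom i p =
    dom i (never-leaving-avoids-entering (Star.map not-leaving p) w≢y)
    where
      not-leaving : ∀ {s t} → (Arc D ∖ (y , _)) s t → (Arc D ⇂ (_≢ y)) s t
      not-leaving (e , ne) = e , λ { refl → other-exit (_ , (λ t≡b → ne (refl , t≡b)) , e) }

  nontransitive-dominates : (∀ u v → ¬ TransitiveArc D u v) → ∀ {x a} → Arc D x a →
    (∀ i → Star (Arc D ∖ (x , a)) x (root i)) → Dominates x a a
  nontransitive-dominates nontransitive xa reach i p = nontransitive _ _ (xa , toPath (reach i ◅◅ p))

  module _ (strong : StrongDigraph D) where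

    dominates-head : ∀ {a b z} → Dominates a b z → Dominates a b b
    dominates-head {z = z} dom i p with split-at-last-use (fromPath (strong (root i) z))
    ... | inj₁ q = dom i q
    ... | inj₂ (_ , _ , suf) = dom i (p ◅◅ suf)

    not-dominated-by-out-arc : I → ∀ {y b} → ¬ Dominates y b y
    not-dominated-by-out-arc i {y} dom with first-hit {E = Arc D} (_≟ y) (fromPath (strong (root i) y)) refl
    ... | _ , refl , q = dom i (Star.map (⇂≢⇒∖ {E = Arc D}) q)

    -- Cut a walk from root j to z after its last use of root i → a, and the rest once more after
    -- its last use of root j → b: the last arc used, followed by the rest, avoids the other arc.
    dominating-roots-unique : ∀ {i j a b z} → Dominates (root i) a z → Dominates (root j) b z → root i ≡ root j
    dominating-roots-unique {i} {j} {a} {b} {z} dom-i dom-j with root i ≟ root j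
    ... | yes eq = eq
    ... | no ne with split-at-last-use {a = root i} {b = a} (fromPath (strong (root j) z))
    ...   | inj₁ q = ⊥-elim (dom-i j q)
    ...   | inj₂ (_ , ia , σ) with split-at-last-use {a = root j} {b = b} σ
    ...     | inj₁ σ′ = ⊥-elim (dom-j i ((ia , ne ∘ proj₁) ◅ Star.map (λ ((e , _) , ne′) → e , ne′) σ′))
    ...     | inj₂ (_ , jb , σ′) = ⊥-elim (dom-i j (jb ◅ Star.map proj₁ σ′))

private
  Next : ∀ {m} → Fin m → Fin m → Set
  Next i j = suc (toℕ i) ≡ toℕ j

  next-from-zero : ∀ {m} (j : Fin (suc m)) → Star Next zero j
  next-from-zero zero = ε
  next-from-zero {suc m} (suc j) = refl ◅ gmap suc (cong suc) (next-from-zero j)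

  next-to-last : ∀ {m} (i : Fin (suc m)) → Star Next i (fromℕ m)
  next-to-last zero = next-from-zero _
  next-to-last {suc m} (suc i) = gmap suc (cong suc) (next-to-last i)

cyclic-walk : ∀ {q} (i j : Fin q) → Star CycSucc i j
cyclic-walk {suc m} i j = Star.map inj₁ (next-to-last i) ◅◅ wrap ◅ Star.map inj₁ (next-from-zero j)
  where
    wrap : CycSucc (fromℕ m) zero
    wrap = inj₂ (cong suc (toℕ-fromℕ m) , refl)

module Component {n} (D : Digraph n) (minimal : MinimalStrong D) {q} (C : DirectedCycle D q)
                 (S : Fin n → Bool) (component : StrongComponent (DeleteCycle D C) S) where
  open DirectedCycle C renaming (vert to cv; inj to cv-injective; arcs to cycle-arcs)
  open Dominators D cv
  open module W {E} = Walks (_≟_ {n}) {E}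

  loopless : Loopless D
  loopless = proj₁ minimal

  strong : StrongDigraph D
  strong = proj₁ (proj₂ minimal)

  nontransitive : ∀ u v → ¬ TransitiveArc D u v
  nontransitive = proj₂ (proj₂ minimal)

  D′ : Fin n → Fin n → Set
  D′ = DeleteCycle D C

  connected : StronglyConnectedOn D′ S
  connected = proj₁ (proj₂ component)

  OnCycle : Fin n → Set
  OnCycle v = ∃ λ i → cv i ≡ v

  cycle-walk : ∀ i j → Star (CycleArc C) (cv i) (cv j)
  cycle-walk i j = gmap cv (λ {i} {j} s → i , j , s , refl , refl) (cyclic-walk i j)

  cycleArc⇒arc : ∀ {x y} → CycleArc C x y → Arc D x y
  cycleArc⇒arc (i , j , s , refl , refl) = cycle-arcs i j s

  cycleArc-tail : ∀ {x y} → CycleArc C x y → OnCycle x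
  cycleArc-tail (i , _ , _ , eq , _) = i , eq

  off-cycle-arc : ∀ {x y} → Arc D x y → ¬ OnCycle x → D′ x y
  off-cycle-arc e x∉C = e , x∉C ∘ cycleArc-tail

  cycle-walk-avoiding : ∀ {y} → ¬ OnCycle y → ∀ i j → Star (Arc D ⇂ (_≢ y)) (cv i) (cv j)
  cycle-walk-avoiding y∉C i j =
    Star.map (λ ca → cycleArc⇒arc ca , λ { refl → y∉C (cycleArc-tail ca) }) (cycle-walk i j)

  dominated-off-cycle : ∀ {a b z} → Dominates a b z → ¬ OnCycle z
  dominated-off-cycle dom (k , cvₖ≡z) = dominated-not-root dom k cvₖ≡z

  root-arc-dominates : ∀ {i a} → D′ (cv i) a → Dominates (cv i) a a
  root-arc-dominates {i} {a} (e , not-cycle) =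
    nontransitive-dominates nontransitive e (λ j → Star.map avoid (cycle-walk i j))
    where
      avoid : ∀ {s t} → CycleArc C s t → (Arc D ∖ (cv i , a)) s t
      avoid ca = cycleArc⇒arc ca , λ { (refl , refl) → not-cycle ca }

  module Descent (i : Fin q) (cvᵢ∈S : T (S (cv i))) where

    exit-towards-cycle : ∀ {y} → T (S y) → ¬ OnCycle y →
      ∃ λ b → Arc D y b × T (S b) × (∀ j → Star (Arc D ⇂ (_≢ y)) b (cv j))
    exit-towards-cycle {y} y∈S y∉C with last-exit (fromPath (connected y (cv i) y∈S cvᵢ∈S)) (y∉C ∘ (i ,_))
    ... | b , ((yb , _) , _ , b∈S) , back =
      b , yb , b∈S , λ j → Star.map forget back ◅◅ cycle-walk-avoiding y∉C i j
      where
        forget : ∀ {s t} → (Induced D′ S ⇂ (_≢ y)) s t → (Arc D ⇂ (_≢ y)) s t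
        forget (((e , _) , _) , s≢y) = e , s≢y

    -- Follow c until it meets the cycle or y. Meeting y closes a D′-cycle through y, so c ∈ S and
    -- y → b → … reaches the cycle avoiding y → c; otherwise y → c → … reaches it avoiding y → b.
    second-exit : ∀ {y b c} → T (S y) → ¬ OnCycle y →
      Arc D y b → T (S b) → (∀ j → Star (Arc D ⇂ (_≢ y)) b (cv j)) → Arc D y c → c ≢ b →
      ∃ λ y′ → Arc D y y′ × T (S y′) × Dominates y y′ y′
    second-exit {y} {b} {c} y∈S y∉C yb b∈S escape yc c≢b
      with first-hit (λ v → any? (λ k → cv k ≟ v) ⊎-dec v ≟ y) (fromPath (strong c (cv i))) (inj₁ (i , refl))
    ... | _ , inj₂ refl , r = c , yc , c∈S , nontransitive-dominates nontransitive yc via-b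
      where
        c∈S : T (S c)
        c∈S = closed-walk-in-component component y∈S
                (off-cycle-arc yc y∉C ◅ Star.map (λ (e , ¬P) → off-cycle-arc e (¬P ∘ inj₁)) r)
                (there (start∈vertices _))
        via-b : ∀ j → Star (Arc D ∖ (y , c)) y (cv j)
        via-b j = (yb , c≢b ∘ sym ∘ proj₂) ◅ Star.map (⇂≢⇒∖ {E = Arc D}) (escape j)
    ... | _ , inj₁ (k , refl) , r = b , yb , b∈S , nontransitive-dominates nontransitive yb via-c
      where
        via-c : ∀ j → Star (Arc D ∖ (y , b)) y (cv j)
        via-c j = (yc , c≢b ∘ proj₂) ◅ Star.map (⇂≢⇒∖ {E = Arc D})
                    (Star.map (λ (e , ¬P) → e , ¬P ∘ inj₂) r ◅◅ cycle-walk-avoiding y∉C k j)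

    descend-step : ∀ {u y} → Arc D u y → T (S y) → Dominates u y y →
      T (linearᵇ D y) ⊎ ∃ λ y′ → Arc D y y′ × T (S y′) × Dominates y y′ y′
    descend-step {u} {y} uy y∈S dom with exit-towards-cycle y∈S (dominated-off-cycle dom)
    ... | b , yb , b∈S , escape with any? (λ c → ¬? (c ≟ b) ×-dec T? (D y c))
    ...   | yes (c , c≢b , yc) = inj₂ (second-exit y∈S (dominated-off-cycle dom) yb b∈S escape yc c≢b)
    ...   | no sole-exit with any? (λ w → ¬? (w ≟ u) ×-dec T? (D w y))
    ...     | yes (w , w≢u , wy) =
                inj₂ (b , yb , b∈S , dominates-head strong
                        (dominates-sole-exit sole-exit w≢y (dominates-in-neighbour dom wy w≢u)))
      where
        w≢y : w ≢ y
        w≢y refl = subst T (loopless w) wy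
    ...     | no sole-entry = inj₁ (linear-from-degrees {D = D} (count-unique uy sole-entry) (count-unique yb sole-exit))

    -- U over-approximates the vertices dominated by the current arc; it loses y at each step.
    descend : ∀ k (U : Fin n → Bool) → count U ≡ k → ∀ {u y} → Arc D u y → T (S y) → Dominates u y y →
      (∀ {z} → Dominates u y z → T (U z)) → ∃ λ ℓ → Dominates u y ℓ × T (S ℓ) × T (linearᵇ D ℓ)
    descend zero U count≡0 uy y∈S dom within with trans (sym count≡0) (count-remove U (within dom))
    ... | ()
    descend (suc k) U count≡ {y = y} uy y∈S dom within with descend-step uy y∈S dom
    ... | inj₁ y-linear = y , dom , y∈S , y-linear
    ... | inj₂ (y′ , yy′ , y′∈S , dom′) with descend k (remove U y) count′ yy′ y′∈S dom′ within′
      where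
        count′ : count (remove U y) ≡ k
        count′ = ℕ.suc-injective (trans (sym (count-remove U (within dom))) count≡)
        within′ : ∀ {z} → Dominates y y′ z → T (remove U y z)
        within′ dom-z = T-remove {f = U} (within (dominates-trans dom dom-z))
                          (λ { refl → not-dominated-by-out-arc strong i dom-z })
    ...   | ℓ , dom-ℓ , ℓ∈S , ℓ-linear = ℓ , dominates-trans dom dom-ℓ , ℓ∈S , ℓ-linear

  module LinearVertices (many : 1 < cycleVerticesIn C S) where

    dominated-linear-vertex : ∀ i → T (S (cv i)) → ∃₂ λ a ℓ → Dominates (cv i) a ℓ × T (S ℓ ∧ linearᵇ D ℓ)
    dominated-linear-vertex i cvᵢ∈S with count-another many cvᵢ∈S
    ... | j , j≢i , cvⱼ∈S
      with first-arc (fromPath (connected (cv i) (cv j) cvᵢ∈S cvⱼ∈S)) (j≢i ∘ sym ∘ cv-injective)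
    ...   | a , (ia , _ , a∈S)
      with Descent.descend i cvᵢ∈S _ (λ _ → true) refl (proj₁ ia) a∈S (root-arc-dominates ia) _
    ...     | ℓ , dom , ℓ∈S , ℓ-linear = a , ℓ , dom , from T-∧ (ℓ∈S , ℓ-linear)

    linear-vertex : ∀ i → T (S (cv i)) → Fin n
    linear-vertex i cvᵢ∈S = proj₁ (proj₂ (dominated-linear-vertex i cvᵢ∈S))

    linear-vertex-S∧linear : ∀ i cvᵢ∈S → T (S (linear-vertex i cvᵢ∈S) ∧ linearᵇ D (linear-vertex i cvᵢ∈S))
    linear-vertex-S∧linear i cvᵢ∈S = proj₂ (proj₂ (proj₂ (dominated-linear-vertex i cvᵢ∈S)))

    linear-vertex-injective : ∀ {i j} cvᵢ∈S cvⱼ∈S → linear-vertex i cvᵢ∈S ≡ linear-vertex j cvⱼ∈S → i ≡ j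
    linear-vertex-injective {i} {j} cvᵢ∈S cvⱼ∈S same =
      cv-injective (dominating-roots-unique strong (dominated i cvᵢ∈S)
                                                   (subst (Dominates (cv j) _) (sym same) (dominated j cvⱼ∈S)))
      where
        dominated : ∀ i cvᵢ∈S → Dominates (cv i) (proj₁ (dominated-linear-vertex i cvᵢ∈S)) (linear-vertex i cvᵢ∈S)
        dominated i cvᵢ∈S = proj₁ (proj₂ (proj₂ (dominated-linear-vertex i cvᵢ∈S)))

theorem3 : ∀ {n} (D : Digraph n) → MinimalStrong D →
    ∀ (q : ℕ) → 2 ≤ q → (C : DirectedCycle D q) →
    (S : Fin n → Bool) → StrongComponent (DeleteCycle D C) S →
    1 < cycleVerticesIn C S →
    cycleVerticesIn C S ≤ linearVerticesIn D S
-- The hypothesis 2 ≤ q is implied by 1 < cycleVerticesIn C S.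
theorem3 D minimal q _ C S component many =
  count-≤-injection _ _ linear-vertex linear-vertex-S∧linear linear-vertex-injective
  where open Component.LinearVertices D minimal C S component many
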